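{- Let $\mathbf{P}=(\omega,\leq_{\mathbf P})$ be an enumerated generic partial order and let $\mathrm{CT}\subseteq\Sigma^*$ be its coding tree (defined below). Then every two words $s,t\in\mathrm{CT}$ are compatible.
   Context: Let $\Sigma=\{\mathrm L,\mathrm X,\mathrm R\}$ be an alphabet ordered by $\mathrm L<_{\mathrm{lex}}\mathrm X<_{\mathrm{lex}}\mathrm R$, and let $\Sigma^*$ be the set of finite words over $\Sigma$, ordered lexicographically by $\leq_{\mathrm{lex}}$; for a word $w=w_0w_1\cdots w_{|w|-1}$, $|w|$ is its length. The generic partial order $\mathbf P$ is the unique (up to isomorphism) countable homogeneous partial order into which every countable partial order embeds; "enumerated" means its vertex set is $\omega$. For $m<\omega$ and vertices $u,v\geq m$, write $u\sim_m v$ if for every $j<m$ we have ($j<_{\mathbf P}u\iff j<_{\mathbf P}v$) and ($u<_{\mathbf P}j\iff v<_{\mathbf P}j$). Let $\mathbb T(m)$ be the set of $\sim_m$-equivalence classes of vertices $\geq m$ (the 1-types over $\{0,\dots,m-1\}$). For $x\in\mathbb T(m)$ define $\sigma(x)\in\Sigma^m$ by, for $j<m$: $\sigma(x)_j=\mathrm L$ if $a<_{\mathbf P}j$ for (every/some) $a\in x$; $\sigma(x)_j=\mathrm R$ if $j<_{\mathbf P}a$ for (every/some) $a\in x$; $\sigma(x)_j=\mathrm X$ otherwise. The coding tree is $\mathrm{CT}=\{\sigma(x): x\in\bigcup_{m<\omega}\mathbb T(m)\}$. Words $u\leq_{\mathrm{lex}}v$ in $\Sigma^*$ are called compatible if (1)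 there is no $\ell<\min(|u|,|v|)$ with $(u_\ell,v_\ell)=(\mathrm R,\mathrm L)$, and (2) if there is $\ell'<\min(|u|,|v|)$ with $(u_{\ell'},v_{\ell'})=(\mathrm L,\mathrm R)$, then $u_{\ell''}\leq_{\mathrm{lex}}v_{\ell''}$ for every $\ell''<\min(|u|,|v|)$. Two words are compatible if, listed in $\leq_{\mathrm{lex}}$-increasing order, they satisfy this. -}

module Defs where

open import Data.Nat using (ℕ; _≤_; _<_)
open import Data.List using (List; []; _∷_; length; zip)
open import Data.List.Membership.Propositional using (_∈_)
open import Data.List.Relation.Unary.All using (All)
open import Data.Product using (Σ; ∃; _×_; _,_; proj₁; proj₂)
open import Data.Empty using (⊥)
open import Relation.Nullary using (¬_)
open import Relation.Binary.PropositionalEquality using (_≡_)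
open import Relation.Binary.Structures using (IsStrictPartialOrder)
open import Function.Definitions using (Injective)
open import Function.Bundles using (_⇔_)

data Sym : Set where
  L X R : Sym

data _<Σ_ : Sym → Sym → Set where
  L<X : L <Σ X
  L<R : L <Σ R
  X<R : X <Σ R

data _≤Σ_ : Sym → Sym → Set where
  ≤Σ-refl : ∀ {a} → a ≤Σ a
  ≤Σ-lt   : ∀ {a b} → a <Σ b → a ≤Σ b

Word : Set
Word = List Sym

data _≤lex_ : Word → Word → Set where
  []≤   : ∀ {v} → [] ≤lex v
  head< : ∀ {a b u v} → a <Σ b → (a ∷ u) ≤lex (b ∷ v)
  head≡ : ∀ {a u v} → u ≤lex v → (a ∷ u) ≤lex (a ∷ v)

-- u, v compatible, under the assumption u ≤lex v
CompatibleOrdered : Word → Word → Set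
CompatibleOrdered u v =
  (¬ ((R , L) ∈ zip u v)) ×
  ((L , R) ∈ zip u v → All (λ p → proj₁ p ≤Σ proj₂ p) (zip u v))

Compatible : Word → Word → Set
Compatible s t =
  (s ≤lex t → CompatibleOrdered s t) × (t ≤lex s → CompatibleOrdered t s)

-- finite partial isomorphisms given as lists of pairs (a , b) meaning a ↦ b
IsFinitePartialIso : (ℕ → ℕ → Set) → List (ℕ × ℕ) → Set
IsFinitePartialIso _<P_ ps =
  ∀ {a b a' b'} → (a , b) ∈ ps → (a' , b') ∈ ps →
    ((a ≡ a') ⇔ (b ≡ b')) × ((a <P a') ⇔ (b <P b'))

IsAutomorphism : (ℕ → ℕ → Set) → (ℕ → ℕ) → Set
IsAutomorphism _<P_ f =
  (Σ (ℕ → ℕ) λ g → (∀ x → g (f x) ≡ x) × (∀ y → f (g y) ≡ y)) ×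
  (∀ x y → (x <P y) ⇔ (f x <P f y))

IsHomogeneous : (ℕ → ℕ → Set) → Set
IsHomogeneous _<P_ =
  ∀ ps → IsFinitePartialIso _<P_ ps →
    Σ (ℕ → ℕ) λ f → IsAutomorphism _<P_ f ×
      (∀ {a b} → (a , b) ∈ ps → f a ≡ b)

IsUniversal : (ℕ → ℕ → Set) → Set₁
IsUniversal _<P_ =
  ∀ (A : Set) (_≺_ : A → A → Set) → IsStrictPartialOrder _≡_ _≺_ →
    (Σ (A → ℕ) λ ι → Injective _≡_ _≡_ ι) →
    Σ (A → ℕ) λ e → Injective _≡_ _≡_ e × (∀ x y → (x ≺ y) ⇔ (e x <P e y))

record IsGenericPO (_<P_ : ℕ → ℕ → Set) : Set₁ where
  field
    isSPO       : IsStrictPartialOrder _≡_ _<P_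
    homogeneous : IsHomogeneous _<P_
    universal   : IsUniversal _<P_

data _at_is_ : Word → ℕ → Sym → Set where
  here  : ∀ {a w} → (a ∷ w) at 0 is a
  there : ∀ {a w j b} → w at j is b → (a ∷ w) at (Data.Nat.suc j) is b

-- σ relation: w = σ(type of a over {0,…,|w|-1}), for a vertex a ≥ |w|
SigmaOf : (ℕ → ℕ → Set) → ℕ → Word → Set
SigmaOf _<P_ a w =
  length w ≤ a ×
  (∀ j → j < length w →
     (w at j is L ⇔ a <P j) ×
     (w at j is R ⇔ j <P a) ×
     (w at j is X ⇔ ((¬ (a <P j)) × (¬ (j <P a)))))

-- CT = { σ(x) : x a 1-type over some finite initial segment }
InCT : (ℕ → ℕ → Set) → Word → Set
InCT _<P_ w = ∃ λ a → SigmaOf _<P_ a w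

{-# OPTIONS --safe #-}

-- If σ(a) = s and σ(b) = t with a <P b, then s ≤ t letter by letter: a letter
-- going down from s to t would force a <P j or j <P b through a <P b,
-- against what the letters say.  A pair (L , R) at position ℓ gives
-- a <P ℓ <P b, which is condition (2).  A pair (R , L) gives b <P a, so
-- t ≤ s letter by letter; together with s ≤lex t this makes s and t agree
-- on all common positions, which contradicts R ≠ L.

module Submission where

open import Defs
open import Data.Nat using (ℕ; _<_; s≤s; z≤n; suc)
open import Data.List using ([]; _∷_; length; zip)
open import Data.List.Membership.Propositional using (_∈_)
open import Data.List.Relation.Unary.Any using (here; there)
open import Data.List.Relation.Unary.All using (All; []; _∷_)
open import Data.Product using (Σ-syntax; _×_; _,_; proj₁; proj₂)
open import Data.Empty using (⊥-elim)
open import Relation.Nullary using (¬_)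
open import Relation.Binary.PropositionalEquality using (_≡_; refl)
open import Relation.Binary.Structures using (IsStrictPartialOrder)
open import Function.Bundles using (Equivalence)

<Σ⇒≱Σ : ∀ {a b} → a <Σ b → ¬ (b ≤Σ a)
<Σ⇒≱Σ L<X (≤Σ-lt ())
<Σ⇒≱Σ L<R (≤Σ-lt ())
<Σ⇒≱Σ X<R (≤Σ-lt ())

at⇒<length : ∀ {w j c} → w at j is c → j < length w
at⇒<length here      = s≤s z≤n
at⇒<length (there p) = s≤s (at⇒<length p)

∈-zip⇒at : ∀ {x y : Sym} u v → (x , y) ∈ zip u v →
  Σ[ j ∈ ℕ ] (u at j is x) × (v at j is y)
∈-zip⇒at (a ∷ u) (b ∷ v) (here refl) = 0 , here , here
∈-zip⇒at (a ∷ u) (b ∷ v) (there m) with ∈-zip⇒at u v m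
... | j , p , q = suc j , there p , there q

_≤pw_ : Word → Word → Set
s ≤pw t = ∀ {j x y} → s at j is x → t at j is y → x ≤Σ y

≤pw⇒All-zip : ∀ s t → s ≤pw t → All (λ p → proj₁ p ≤Σ proj₂ p) (zip s t)
≤pw⇒All-zip []      t       s≤t = []
≤pw⇒All-zip (a ∷ s) []      s≤t = []
≤pw⇒All-zip (a ∷ s) (b ∷ t) s≤t =
  s≤t here here ∷ ≤pw⇒All-zip s t (λ p q → s≤t (there p) (there q))

≤lex∧≥pw⇒agree : ∀ {s t j x y} → s ≤lex t → t ≤pw s →
  s at j is x → t at j is y → x ≡ y
≤lex∧≥pw⇒agree []≤         t≤s ()
≤lex∧≥pw⇒agree (head< a<b) t≤s here      here      = ⊥-elim (<Σ⇒≱Σ a<b (t≤s here here))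
≤lex∧≥pw⇒agree (head≡ s≤t) t≤s here      here      = refl
≤lex∧≥pw⇒agree (head< a<b) t≤s (there p) (there q) = ⊥-elim (<Σ⇒≱Σ a<b (t≤s here here))
≤lex∧≥pw⇒agree (head≡ s≤t) t≤s (there p) (there q) =
  ≤lex∧≥pw⇒agree s≤t (λ p′ q′ → t≤s (there p′) (there q′)) p q

module _ {_<P_ : ℕ → ℕ → Set} (isSPO : IsStrictPartialOrder _≡_ _<P_) where
  open IsStrictPartialOrder isSPO using (irrefl; trans)

  module Letters {a w} (σ : SigmaOf _<P_ a w) where
    open Equivalence

    L⇒above : ∀ {j} → w at j is L → a <P j
    L⇒above p = to (proj₁ (proj₂ σ _ (at⇒<length p))) p

    R⇒below : ∀ {j} → w at j is R → j <P a
    R⇒below p = to (proj₁ (proj₂ (proj₂ σ _ (at⇒<length p)))) p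

    X⇒incomparable : ∀ {j} → w at j is X → ¬ (a <P j) × ¬ (j <P a)
    X⇒incomparable p = to (proj₂ (proj₂ (proj₂ σ _ (at⇒<length p)))) p

  σ-monotone : ∀ {a b s t} → a <P b →
    SigmaOf _<P_ a s → SigmaOf _<P_ b t → s ≤pw t
  σ-monotone {s = s} {t} a<b σs σt = monotone
    where
    open Letters σs renaming (L⇒above to s-L; R⇒below to s-R; X⇒incomparable to s-X)
    open Letters σt renaming (L⇒above to t-L; R⇒below to t-R; X⇒incomparable to t-X)
    monotone : s ≤pw t
    monotone {x = L} {L} p q = ≤Σ-refl
    monotone {x = L} {X} p q = ≤Σ-lt L<X
    monotone {x = L} {R} p q = ≤Σ-lt L<R
    monotone {x = X} {L} p q = ⊥-elim (proj₁ (s-X p) (trans a<b (t-L q)))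
    monotone {x = X} {X} p q = ≤Σ-refl
    monotone {x = X} {R} p q = ≤Σ-lt X<R
    monotone {x = R} {L} p q = ⊥-elim (irrefl refl (trans (trans (s-R p) a<b) (t-L q)))
    monotone {x = R} {X} p q = ⊥-elim (proj₂ (t-X q) (trans (s-R p) a<b))
    monotone {x = R} {R} p q = ≤Σ-refl

  σ-compatibleOrdered : ∀ {a b s t} →
    SigmaOf _<P_ a s → SigmaOf _<P_ b t → s ≤lex t → CompatibleOrdered s t
  σ-compatibleOrdered {s = s} {t} σs σt s≤t = noRL , LR⇒≤
    where
    noRL : ¬ ((R , L) ∈ zip s t)
    noRL m with ∈-zip⇒at s t m
    ... | ℓ , p , q with ≤lex∧≥pw⇒agree s≤t (σ-monotone b<a σt σs) p q
      where b<a = trans (Letters.L⇒above σt q) (Letters.R⇒below σs p)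
    ... | ()
    LR⇒≤ : (L , R) ∈ zip s t → All (λ p → proj₁ p ≤Σ proj₂ p) (zip s t)
    LR⇒≤ m with ∈-zip⇒at s t m
    ... | ℓ , p , q = ≤pw⇒All-zip s t (σ-monotone a<b σs σt)
      where a<b = trans (Letters.L⇒above σs p) (Letters.R⇒below σt q)

mainTheorem1 : (_<P_ : ℕ → ℕ → Set) → IsGenericPO _<P_ →
    ∀ s t → InCT _<P_ s → InCT _<P_ t → Compatible s t
mainTheorem1 _<P_ generic s t (a , σs) (b , σt) =
  σ-compatibleOrdered isSPO σs σt , σ-compatibleOrdered isSPO σt σs
  where open IsGenericPO generic using (isSPO)
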